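{- For any integer $a\geq 1$, $N_2(K_{a,1,1})=a+1$.
   Context: For a connected graph $G=(V,E)$, $N_2(G)$ is the minimum $N$ such that there is a map $g:V\to\{0,1,*\}^N$ with the property that for all $x,y\in V$, the graph distance between $x$ and $y$ equals the number of positions $j$ in which the $j$-th entries of $g(x)$ and $g(y)$ are distinct and neither equals $*$. $K_{a,b,c}$ denotes the complete tripartite graph with parts of sizes $a,b,c$. -}

module Defs where

open import Data.Nat using (ℕ; zero; suc; _+_; _≤_)
open import Data.Fin using (Fin)
open import Data.Vec using (Vec; []; _∷_)
open import Data.Sum using (_⊎_; inj₁; inj₂)
open import Data.Product using (Σ; _×_; _,_)
open import Relation.Nullary using (¬_)
open import Relation.Binary.PropositionalEquality using (_≡_)

record Graph : Set₁ where
  field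
    V   : Set
    Adj : V → V → Set

open Graph public

data Walk (G : Graph) : V G → V G → ℕ → Set where
  here : ∀ {x} → Walk G x x 0
  step : ∀ {x y z n} → Adj G x y → Walk G y z n → Walk G x z (suc n)

Dist : (G : Graph) → V G → V G → ℕ → Set
Dist G x y d = Walk G x y d × (∀ m → Walk G x y m → d ≤ m)

Connected : Graph → Set
Connected G = ∀ x y → Σ ℕ (λ n → Walk G x y n)

data Sym : Set where
  s0 s1 star : Sym

conflict : Sym → Sym → ℕ
conflict s0 s1 = 1
conflict s1 s0 = 1
conflict _  _  = 0

conflicts : ∀ {N} → Vec Sym N → Vec Sym N → ℕ
conflicts []       []       = 0
conflicts (u ∷ us) (v ∷ vs) = conflict u v + conflicts us vs

IsSquashed : (G : Graph) (N : ℕ) → (V G → Vec Sym N) → Set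
IsSquashed G N g = ∀ x y → Dist G x y (conflicts (g x) (g y))

N₂≡ : Graph → ℕ → Set
N₂≡ G N =
  Σ (V G → Vec Sym N) (IsSquashed G N) ×
  (∀ M (g : V G → Vec Sym M) → IsSquashed G M g → N ≤ M)

part : ∀ {a b c} → Fin a ⊎ (Fin b ⊎ Fin c) → Fin 3
part (inj₁ _)        = Fin.zero
part (inj₂ (inj₁ _)) = Fin.suc Fin.zero
part (inj₂ (inj₂ _)) = Fin.suc (Fin.suc Fin.zero)

K : ℕ → ℕ → ℕ → Graph
K a b c = record
  { V   = Fin a ⊎ (Fin b ⊎ Fin c)
  ; Adj = λ x y → ¬ (part x ≡ part y)
  }

-- The upper bound labels the a pairwise non-adjacent vertices with the unit vectors of {0,1}^a
-- followed by *, and the two remaining vertices u, v with the zero vector followed by 0 and 1.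
--
-- The lower bound is the Graham–Pollak–Witsenhausen argument. A coordinate of a squashed-cube
-- embedding contributes 2 (z · w) (o · w) to the distance form Q(w) = Σ w_x w_y d(x,y), where z and
-- o mark the vertices whose entry there is 0 resp. 1. If the length M were at most a, the M
-- equations z · w = 0 together with w_u + w_v + 2 Σ_i w_i = 0 would have a nonzero integer solution
-- in a + 2 unknowns, and then Q(w) = 0. But (w_u + w_v + 2 Σ_i w_i)² - 2 Q(w) = (w_u - w_v)² + 4 Σ_i w_i²,
-- so w_u = w_v and every w_i vanishes, after which the extra equation forces w = 0.

module Submission where

open import Data.Nat as ℕ using (ℕ; zero; suc; z≤n; s≤s)
import Data.Nat.Properties as ℕ
open import Data.Fin as Fin using (Fin; zero; suc)
open import Data.Vec as Vec using (Vec; []; _∷_)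
open import Data.Vec.Functional using (Vector; tail)
open import Data.List using (List; []; _∷_; length; map)
import Data.List.Properties as List
open import Data.List.Relation.Unary.All as All using (All; []; _∷_)
open import Data.List.Relation.Unary.All.Properties using (map⁻)
open import Data.List.Relation.Binary.Permutation.Propositional using (_↭_; prep; swap; ↭-refl; ↭-sym; ↭-trans)
open import Data.List.Relation.Binary.Permutation.Propositional.Properties using (All-resp-↭; ↭-length)
open import Data.Product using (∃; ∃₂; _×_; _,_)
open import Data.Sum using (_⊎_; inj₁; inj₂)
open import Data.Empty using (⊥; ⊥-elim)
open import Function using (case_of_)
open import Relation.Nullary using (¬_; yes; no)
open import Relation.Unary using (Decidable)
open import Relation.Binary.PropositionalEquality
  using (_≡_; _≢_; refl; sym; trans; cong; cong₂; subst; module ≡-Reasoning)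

open import Defs

module _ {G : Graph} where

  walk-length-0 : ∀ {x y} → Walk G x y 0 → x ≡ y
  walk-length-0 here = refl

  walk-length-1 : ∀ {x y} → Walk G x y 1 → Adj G x y
  walk-length-1 (step xy here) = xy

  dist-unique : ∀ {x y m n} → Dist G x y m → Dist G x y n → m ≡ n
  dist-unique (walk-m , shortest-m) (walk-n , shortest-n) = ℕ.≤-antisym (shortest-m _ walk-n) (shortest-n _ walk-m)

  dist-refl : ∀ {x} → Dist G x x 0
  dist-refl = here , λ _ _ → z≤n

  dist-adjacent : ∀ {x y} → x ≢ y → Adj G x y → Dist G x y 1
  dist-adjacent x≢y xy = step xy here , shortest
    where
    shortest : ∀ m → Walk G _ _ m → 1 ℕ.≤ m
    shortest zero    walk = ⊥-elim (x≢y (walk-length-0 walk))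
    shortest (suc _) _    = s≤s z≤n

  dist-two : ∀ {x y z} → x ≢ y → ¬ Adj G x y → Adj G x z → Adj G z y → Dist G x y 2
  dist-two x≢y ¬xy xz zy = step xz (step zy here) , shortest
    where
    shortest : ∀ m → Walk G _ _ m → 2 ℕ.≤ m
    shortest zero          walk = ⊥-elim (x≢y (walk-length-0 walk))
    shortest (suc zero)    walk = ⊥-elim (¬xy (walk-length-1 walk))
    shortest (suc (suc _)) _    = s≤s (s≤s z≤n)

apart : ∀ {n} → Fin n → Fin n → ℕ
apart zero    zero    = 0
apart zero    (suc _) = 1
apart (suc _) zero    = 1
apart (suc i) (suc k) = apart i k

apart-refl : ∀ {n} (i : Fin n) → apart i i ≡ 0
apart-refl zero    = refl
apart-refl (suc i) = apart-refl i

apart-≢ : ∀ {n} {i k : Fin n} → i ≢ k → apart i k ≡ 1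
apart-≢ {i = zero}  {zero}  i≢k = ⊥-elim (i≢k refl)
apart-≢ {i = zero}  {suc _} _   = refl
apart-≢ {i = suc _} {zero}  _   = refl
apart-≢ {i = suc i} {suc k} i≢k = apart-≢ (λ i≡k → i≢k (cong suc i≡k))

distance : ∀ {a} → V (K a 1 1) → V (K a 1 1) → ℕ
distance (inj₁ i)        (inj₁ k)        = 2 ℕ.* apart i k
distance (inj₁ _)        (inj₂ _)        = 1
distance (inj₂ _)        (inj₁ _)        = 1
distance (inj₂ (inj₁ _)) (inj₂ (inj₁ _)) = 0
distance (inj₂ (inj₁ _)) (inj₂ (inj₂ _)) = 1
distance (inj₂ (inj₂ _)) (inj₂ (inj₁ _)) = 1
distance (inj₂ (inj₂ _)) (inj₂ (inj₂ _)) = 0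

distance-correct : ∀ {a} (x y : V (K a 1 1)) → Dist (K a 1 1) x y (distance x y)
distance-correct (inj₁ i) (inj₁ k) with i Fin.≟ k
... | yes refl rewrite apart-refl i = dist-refl
... | no i≢k   rewrite apart-≢ i≢k =
  dist-two {z = inj₂ (inj₁ zero)} (λ { refl → i≢k refl }) (λ xy → xy refl) (λ ()) (λ ())
distance-correct (inj₁ _)           (inj₂ (inj₁ _))    = dist-adjacent (λ ()) (λ ())
distance-correct (inj₁ _)           (inj₂ (inj₂ _))    = dist-adjacent (λ ()) (λ ())
distance-correct (inj₂ (inj₁ _))    (inj₁ _)           = dist-adjacent (λ ()) (λ ())
distance-correct (inj₂ (inj₂ _))    (inj₁ _)           = dist-adjacent (λ ()) (λ ())
distance-correct (inj₂ (inj₁ zero)) (inj₂ (inj₁ zero)) = dist-refl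
distance-correct (inj₂ (inj₁ zero)) (inj₂ (inj₂ zero)) = dist-adjacent (λ ()) (λ ())
distance-correct (inj₂ (inj₂ zero)) (inj₂ (inj₁ zero)) = dist-adjacent (λ ()) (λ ())
distance-correct (inj₂ (inj₂ zero)) (inj₂ (inj₂ zero)) = dist-refl

squashed-conflicts : ∀ {a M} (g : V (K a 1 1) → Vec Sym M) → IsSquashed (K a 1 1) M g →
  ∀ x y → conflicts (g x) (g y) ≡ distance x y
squashed-conflicts g squashed x y = dist-unique (squashed x y) (distance-correct x y)

conflicts-[] : ∀ (u v : Vec Sym 0) → conflicts u v ≡ 0
conflicts-[] [] [] = refl

conflicts-∷ : ∀ {M} (u v : Vec Sym (suc M)) →
  conflicts u v ≡ conflict (Vec.head u) (Vec.head v) ℕ.+ conflicts (Vec.tail u) (Vec.tail v)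
conflicts-∷ (_ ∷ _) (_ ∷ _) = refl

conflicts-++ : ∀ {m n} (u u′ : Vec Sym m) (v v′ : Vec Sym n) →
  conflicts (u Vec.++ v) (u′ Vec.++ v′) ≡ conflicts u u′ ℕ.+ conflicts v v′
conflicts-++ []      []        v v′ = refl
conflicts-++ (p ∷ u) (p′ ∷ u′) v v′ =
  trans (cong (conflict p p′ ℕ.+_) (conflicts-++ u u′ v v′)) (sym (ℕ.+-assoc (conflict p p′) _ _))

zeros : ∀ n → Vec Sym n
zeros n = Vec.replicate n s0

indicator : ∀ {n} → Fin n → Vec Sym n
indicator {suc n} zero = s1 ∷ zeros n
indicator (suc i)      = s0 ∷ indicator i

conflicts-zeros : ∀ n → conflicts (zeros n) (zeros n) ≡ 0
conflicts-zeros zero    = refl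
conflicts-zeros (suc n) = conflicts-zeros n

conflicts-zeros-indicator : ∀ {n} (i : Fin n) → conflicts (zeros n) (indicator i) ≡ 1
conflicts-zeros-indicator {suc n} zero = cong suc (conflicts-zeros n)
conflicts-zeros-indicator (suc i)      = conflicts-zeros-indicator i

conflicts-indicator-zeros : ∀ {n} (i : Fin n) → conflicts (indicator i) (zeros n) ≡ 1
conflicts-indicator-zeros {suc n} zero = cong suc (conflicts-zeros n)
conflicts-indicator-zeros (suc i)      = conflicts-indicator-zeros i

conflicts-indicator : ∀ {n} (i k : Fin n) → conflicts (indicator i) (indicator k) ≡ 2 ℕ.* apart i k
conflicts-indicator {suc n} zero zero = conflicts-zeros n
conflicts-indicator zero    (suc k)   = cong suc (conflicts-zeros-indicator k)
conflicts-indicator (suc i) zero      = cong suc (conflicts-indicator-zeros i)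
conflicts-indicator (suc i) (suc k)   = conflicts-indicator i k

code-prefix : ∀ {a} → V (K a 1 1) → Vec Sym a
code-prefix (inj₁ i) = indicator i
code-prefix (inj₂ _) = zeros _

code-last : ∀ {a} → V (K a 1 1) → Sym
code-last (inj₁ _)        = star
code-last (inj₂ (inj₁ _)) = s0
code-last (inj₂ (inj₂ _)) = s1

code : ∀ {a} → V (K a 1 1) → Vec Sym (a ℕ.+ 1)
code x = code-prefix x Vec.++ Vec.[ code-last x ]

conflicts-code : ∀ {a} (x y : V (K a 1 1)) → conflicts (code x) (code y) ≡ distance x y
conflicts-code x y = trans (conflicts-++ (code-prefix x) (code-prefix y) _ _) (by-cases x y)
  where
  by-cases : ∀ {a} (x y : V (K a 1 1)) →
    conflicts (code-prefix x) (code-prefix y) ℕ.+ conflicts Vec.[ code-last x ] Vec.[ code-last y ] ≡ distance x y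
  by-cases {a} (inj₁ i)        (inj₁ k)        = trans (ℕ.+-identityʳ _) (conflicts-indicator i k)
  by-cases {a} (inj₁ i)        (inj₂ (inj₁ _)) = cong (ℕ._+ 0) (conflicts-indicator-zeros i)
  by-cases {a} (inj₁ i)        (inj₂ (inj₂ _)) = cong (ℕ._+ 0) (conflicts-indicator-zeros i)
  by-cases {a} (inj₂ (inj₁ _)) (inj₁ k)        = cong (ℕ._+ 0) (conflicts-zeros-indicator k)
  by-cases {a} (inj₂ (inj₂ _)) (inj₁ k)        = cong (ℕ._+ 0) (conflicts-zeros-indicator k)
  by-cases {a} (inj₂ (inj₁ _)) (inj₂ (inj₁ _)) = cong (ℕ._+ 0) (conflicts-zeros a)
  by-cases {a} (inj₂ (inj₁ _)) (inj₂ (inj₂ _)) = cong (ℕ._+ 1) (conflicts-zeros a)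
  by-cases {a} (inj₂ (inj₂ _)) (inj₂ (inj₁ _)) = cong (ℕ._+ 1) (conflicts-zeros a)
  by-cases {a} (inj₂ (inj₂ _)) (inj₂ (inj₂ _)) = cong (ℕ._+ 0) (conflicts-zeros a)

code-squashed : ∀ {a} → IsSquashed (K a 1 1) (a ℕ.+ 1) code
code-squashed x y = subst (Dist (K _ 1 1) x y) (sym (conflicts-code x y)) (distance-correct x y)

-- A section, so that the integer operations opened here stay out of the scope of mainTheorem11.
module _ where

  open import Data.Integer as ℤ using (ℤ; +_; -[1+_]; 0ℤ; _*_; _+_; _-_; -_)
  import Data.Integer.Properties as ℤ
  open import Data.Integer.Tactic.RingSolver using (solve-∀)
  open import Algebra.Properties.Semiring.Sum ℤ.+-*-semiring
    using (sum; sum-syntax; sum-cong-≗; sum-replicate-zero; ∑-distrib-+; *-distribˡ-sum; *-distribʳ-sum)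

  ∑-linear : ∀ {n} c d (f g : Vector ℤ n) → ∑[ i < n ] (c * f i + d * g i) ≡ c * sum f + d * sum g
  ∑-linear c d f g = trans (∑-distrib-+ (λ i → c * f i) (λ i → d * g i))
                           (sym (cong₂ _+_ (*-distribˡ-sum c f) (*-distribˡ-sum d g)))

  infix 7 _·_

  _·_ : ∀ {n} → Vector ℤ n → Vector ℤ n → ℤ
  u · w = ∑[ i < _ ] (u i * w i)

  ·-linearˡ : ∀ {n} c d (u v w : Vector ℤ n) → (λ i → c * u i + d * v i) · w ≡ c * (u · w) + d * (v · w)
  ·-linearˡ c d u v w = trans (sum-cong-≗ (λ i → distrib c d (u i) (v i) (w i)))
                              (∑-linear c d (λ i → u i * w i) (λ i → v i * w i))
    where
    distrib : ∀ c d x y z → (c * x + d * y) * z ≡ c * (x * z) + d * (y * z)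
    distrib = solve-∀

  ·-scaleʳ : ∀ {n} c (u w : Vector ℤ n) → u · (λ i → c * w i) ≡ c * (u · w)
  ·-scaleʳ c u w = trans (sum-cong-≗ (λ i → swap-scalar c (u i) (w i))) (sym (*-distribˡ-sum c (λ i → u i * w i)))
    where
    swap-scalar : ∀ c x y → x * (c * y) ≡ c * (x * y)
    swap-scalar = solve-∀

  ·-zeroʳ : ∀ {n} (u : Vector ℤ n) → u · (λ _ → 0ℤ) ≡ 0ℤ
  ·-zeroʳ {n} u = trans (sum-cong-≗ (λ i → ℤ.*-zeroʳ (u i))) (sum-replicate-zero n)

  all-or-counterexample : ∀ {A : Set} {P : A → Set} → Decidable P → (xs : List A) →
    All P xs ⊎ ∃₂ λ x ys → ¬ P x × xs ↭ x ∷ ys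
  all-or-counterexample P? [] = inj₁ []
  all-or-counterexample P? (x ∷ xs) with P? x
  ... | no ¬px = inj₂ (x , xs , ¬px , ↭-refl)
  ... | yes px with all-or-counterexample P? xs
  ...   | inj₁ all = inj₁ (px ∷ all)
  ...   | inj₂ (y , ys , ¬py , xs↭) = inj₂ (y , x ∷ ys , ¬py , ↭-trans (prep x xs↭) (swap x y ↭-refl))

  -- Elimination of the first unknown with pivot row E, and the matching back substitution.
  eliminate : ∀ {n} → Vector ℤ (suc n) → Vector ℤ (suc n) → Vector ℤ n
  eliminate E F i = E zero * F (suc i) + (- F zero) * E (suc i)

  extend : ∀ {n} → Vector ℤ (suc n) → Vector ℤ n → Vector ℤ (suc n)
  extend E w zero    = - (tail E · w)
  extend E w (suc i) = E zero * w i

  ·-extend-pivot : ∀ {n} (E : Vector ℤ (suc n)) w → E · extend E w ≡ 0ℤ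
  ·-extend-pivot E w = trans (cong (λ t → E zero * - (tail E · w) + t) (·-scaleʳ (E zero) (tail E) w))
                             (cancel (E zero) (tail E · w))
    where
    cancel : ∀ c x → c * - x + c * x ≡ 0ℤ
    cancel = solve-∀

  ·-extend : ∀ {n} (E F : Vector ℤ (suc n)) w → F · extend E w ≡ eliminate E F · w
  ·-extend E F w = begin
    F zero * - (tail E · w) + tail F · (λ i → E zero * w i)
      ≡⟨ cong (λ t → F zero * - (tail E · w) + t) (·-scaleʳ (E zero) (tail F) w) ⟩
    F zero * - (tail E · w) + E zero * (tail F · w)
      ≡⟨ reorder (F zero) (E zero) (tail E · w) (tail F · w) ⟩
    E zero * (tail F · w) + (- F zero) * (tail E · w)
      ≡⟨ ·-linearˡ (E zero) (- F zero) (tail F) (tail E) w ⟨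
    eliminate E F · w ∎
    where
    open ≡-Reasoning
    reorder : ∀ f e x y → f * - x + e * y ≡ e * y + (- f) * x
    reorder = solve-∀

  extend-nonzero : ∀ {n} {E : Vector ℤ (suc n)} {w} → E zero ≢ 0ℤ →
    ¬ (∀ i → w i ≡ 0ℤ) → ¬ (∀ i → extend E w i ≡ 0ℤ)
  extend-nonzero {E = E} E₀≢0 w≢0 extend≡0 = w≢0 λ i → right-factor (ℤ.i*j≡0⇒i≡0∨j≡0 (E zero) (extend≡0 (suc i)))
    where
    right-factor : ∀ {x} → E zero ≡ 0ℤ ⊎ x ≡ 0ℤ → x ≡ 0ℤ
    right-factor (inj₁ E₀≡0) = ⊥-elim (E₀≢0 E₀≡0)
    right-factor (inj₂ x≡0)  = x≡0

  basis₀ : ∀ {n} → Vector ℤ (suc n)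
  basis₀ zero    = + 1
  basis₀ (suc _) = 0ℤ

  ·-basis₀ : ∀ {n} (E : Vector ℤ (suc n)) → E zero ≡ 0ℤ → E · basis₀ ≡ 0ℤ
  ·-basis₀ E E₀≡0 = cong₂ _+_ (trans (ℤ.*-identityʳ (E zero)) E₀≡0) (·-zeroʳ (tail E))

  nontrivial-solution : ∀ n (Es : List (Vector ℤ n)) → length Es ℕ.< n →
    ∃ λ w → ¬ (∀ i → w i ≡ 0ℤ) × All (λ E → E · w ≡ 0ℤ) Es
  nontrivial-solution zero    Es ()
  nontrivial-solution (suc n) Es len< with all-or-counterexample (λ E → E zero ℤ.≟ 0ℤ) Es
  ... | inj₁ column≡0 = basis₀ , (λ basis≡0 → case basis≡0 zero of λ ()) , All.map (λ {E} → ·-basis₀ E) column≡0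
  ... | inj₂ (E , Rest , E₀≢0 , Es↭) with nontrivial-solution n (map (eliminate E) Rest) fewer-equations
    where
    fewer-equations : length (map (eliminate E) Rest) ℕ.< n
    fewer-equations rewrite List.length-map (eliminate E) Rest | ↭-length Es↭ = ℕ.s≤s⁻¹ len<
  ...   | w , w≢0 , solves = extend E w , extend-nonzero E₀≢0 w≢0 ,
          All-resp-↭ (↭-sym Es↭) (·-extend-pivot E w ∷ All.map (λ {F} → trans (·-extend E F w)) (map⁻ solves))

  quadratic-form : ∀ {n} → (Fin n → Fin n → ℤ) → Vector ℤ n → ℤ
  quadratic-form {n} D w = ∑[ x < n ] ∑[ y < n ] (w x * w y * D x y)

  quadratic-form-cong : ∀ {n} {D D′ : Fin n → Fin n → ℤ} w → (∀ x y → D x y ≡ D′ x y) →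
    quadratic-form D w ≡ quadratic-form D′ w
  quadratic-form-cong w D≡D′ = sum-cong-≗ λ x → sum-cong-≗ λ y → cong (w x * w y *_) (D≡D′ x y)

  quadratic-form-+ : ∀ {n} (D D′ : Fin n → Fin n → ℤ) w →
    quadratic-form (λ x y → D x y + D′ x y) w ≡ quadratic-form D w + quadratic-form D′ w
  quadratic-form-+ {n} D D′ w =
    trans (sum-cong-≗ λ x → trans (sum-cong-≗ λ y → ℤ.*-distribˡ-+ (w x * w y) (D x y) (D′ x y))
                                  (∑-distrib-+ {n} _ _))
          (∑-distrib-+ {n} _ _)

  quadratic-form-zero : ∀ {n} (w : Vector ℤ n) → quadratic-form (λ _ _ → 0ℤ) w ≡ 0ℤ
  quadratic-form-zero {n} w =
    trans (sum-cong-≗ λ x → trans (sum-cong-≗ λ y → ℤ.*-zeroʳ (w x * w y)) (sum-replicate-zero n))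
          (sum-replicate-zero n)

  quadratic-form-rank-one : ∀ {n} (a b w : Vector ℤ n) →
    quadratic-form (λ x y → a x * b y) w ≡ (a · w) * (b · w)
  quadratic-form-rank-one {n} a b w = begin
    ∑[ x < n ] ∑[ y < n ] (w x * w y * (a x * b y))
      ≡⟨ sum-cong-≗ (λ x → trans (sum-cong-≗ λ y → regroup (w x) (w y) (a x) (b y))
                                 (sym (*-distribˡ-sum {n} (a x * w x) _))) ⟩
    ∑[ x < n ] ((a x * w x) * (b · w))
      ≡⟨ *-distribʳ-sum {n} (b · w) _ ⟨
    (a · w) * (b · w) ∎
    where
    open ≡-Reasoning
    regroup : ∀ wx wy ax by → wx * wy * (ax * by) ≡ (ax * wx) * (by * wy)
    regroup = solve-∀

  is0 is1 : Sym → ℤ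
  is0 s0 = + 1
  is0 _  = 0ℤ
  is1 s1 = + 1
  is1 _  = 0ℤ

  conflict≡is0*is1+is1*is0 : ∀ p q → + conflict p q ≡ is0 p * is1 q + is1 p * is0 q
  conflict≡is0*is1+is1*is0 s0   s0   = refl
  conflict≡is0*is1+is1*is0 s0   s1   = refl
  conflict≡is0*is1+is1*is0 s0   star = refl
  conflict≡is0*is1+is1*is0 s1   s0   = refl
  conflict≡is0*is1+is1*is0 s1   s1   = refl
  conflict≡is0*is1+is1*is0 s1   star = refl
  conflict≡is0*is1+is1*is0 star s0   = refl
  conflict≡is0*is1+is1*is0 star s1   = refl
  conflict≡is0*is1+is1*is0 star star = refl

  zero-indicators : ∀ {n M} → (Fin n → Vec Sym M) → List (Vector ℤ n)
  zero-indicators {M = zero}  h = []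
  zero-indicators {M = suc M} h = (λ x → is0 (Vec.head (h x))) ∷ zero-indicators (λ x → Vec.tail (h x))

  length-zero-indicators : ∀ {n M} (h : Fin n → Vec Sym M) → length (zero-indicators h) ≡ M
  length-zero-indicators {M = zero}  h = refl
  length-zero-indicators {M = suc M} h = cong suc (length-zero-indicators (λ x → Vec.tail (h x)))

  conflict-form-vanishes : ∀ {n M} (h : Fin n → Vec Sym M) (w : Vector ℤ n) →
    All (λ E → E · w ≡ 0ℤ) (zero-indicators h) → quadratic-form (λ x y → + conflicts (h x) (h y)) w ≡ 0ℤ
  conflict-form-vanishes {M = zero} h w [] =
    trans (quadratic-form-cong w λ x y → cong +_ (conflicts-[] (h x) (h y))) (quadratic-form-zero w)
  conflict-form-vanishes {M = suc M} h w (z·w≡0 ∷ rest) = begin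
    quadratic-form (λ x y → + conflicts (h x) (h y)) w
      ≡⟨ quadratic-form-cong w split ⟩
    quadratic-form (λ x y → (z x * o y + o x * z y) + C x y) w
      ≡⟨ quadratic-form-+ _ C w ⟩
    quadratic-form (λ x y → z x * o y + o x * z y) w + quadratic-form C w
      ≡⟨ cong₂ _+_ (quadratic-form-+ _ _ w) (conflict-form-vanishes (λ x → Vec.tail (h x)) w rest) ⟩
    quadratic-form (λ x y → z x * o y) w + quadratic-form (λ x y → o x * z y) w + 0ℤ
      ≡⟨ cong (_+ 0ℤ) (cong₂ _+_ (quadratic-form-rank-one z o w) (quadratic-form-rank-one o z w)) ⟩
    (z · w) * (o · w) + (o · w) * (z · w) + 0ℤ
      ≡⟨ cong (λ t → t * (o · w) + (o · w) * t + 0ℤ) z·w≡0 ⟩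
    0ℤ * (o · w) + (o · w) * 0ℤ + 0ℤ
      ≡⟨ annihilate (o · w) ⟩
    0ℤ ∎
    where
    open ≡-Reasoning
    z o : Vector ℤ _
    z x = is0 (Vec.head (h x))
    o x = is1 (Vec.head (h x))
    C : Fin _ → Fin _ → ℤ
    C x y = + conflicts (Vec.tail (h x)) (Vec.tail (h y))
    split : ∀ x y → + conflicts (h x) (h y) ≡ (z x * o y + o x * z y) + C x y
    split x y = trans (cong +_ (conflicts-∷ (h x) (h y)))
                      (trans (ℤ.pos-+ (conflict (Vec.head (h x)) (Vec.head (h y))) _)
                             (cong (_+ C x y) (conflict≡is0*is1+is1*is0 (Vec.head (h x)) (Vec.head (h y)))))
    annihilate : ∀ t → 0ℤ * t + t * 0ℤ + 0ℤ ≡ 0ℤ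
    annihilate = solve-∀

  0≤square : ∀ x → 0ℤ ℤ.≤ x * x
  0≤square (+ n)    = subst (0ℤ ℤ.≤_) (ℤ.pos-* n n) (ℤ.+≤+ z≤n)
  0≤square -[1+ n ] = ℤ.+≤+ z≤n

  0≤∑-squares : ∀ {n} (f : Vector ℤ n) → 0ℤ ℤ.≤ ∑[ i < n ] (f i * f i)
  0≤∑-squares {zero}  f = ℤ.≤-refl
  0≤∑-squares {suc n} f = ℤ.+-mono-≤ (0≤square (f zero)) (0≤∑-squares (tail f))

  nonneg-+≡0⇒≡0 : ∀ {i j} → 0ℤ ℤ.≤ i → 0ℤ ℤ.≤ j → i + j ≡ 0ℤ → i ≡ 0ℤ
  nonneg-+≡0⇒≡0 {i} {j} 0≤i 0≤j i+j≡0 = ℤ.≤-antisym (ℤ.≤-trans i≤i+j (ℤ.≤-reflexive i+j≡0)) 0≤i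
    where
    i≤i+j : i ℤ.≤ i + j
    i≤i+j = subst (ℤ._≤ i + j) (ℤ.+-identityʳ i) (ℤ.+-monoʳ-≤ i 0≤j)

  square≡0⇒≡0 : ∀ x → x * x ≡ 0ℤ → x ≡ 0ℤ
  square≡0⇒≡0 x x²≡0 with ℤ.i*j≡0⇒i≡0∨j≡0 x x²≡0
  ... | inj₁ x≡0 = x≡0
  ... | inj₂ x≡0 = x≡0

  ∑-squares≡0⇒≡0 : ∀ {n} (f : Vector ℤ n) → ∑[ i < n ] (f i * f i) ≡ 0ℤ → ∀ i → f i ≡ 0ℤ
  ∑-squares≡0⇒≡0 f ∑≡0 zero =
    square≡0⇒≡0 (f zero) (nonneg-+≡0⇒≡0 (0≤square (f zero)) (0≤∑-squares (tail f)) ∑≡0)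
  ∑-squares≡0⇒≡0 f ∑≡0 (suc i) =
    ∑-squares≡0⇒≡0 (tail f) (nonneg-+≡0⇒≡0 (0≤∑-squares (tail f)) (0≤square (f zero))
                                           (trans (ℤ.+-comm _ (f zero * f zero)) ∑≡0)) i

  ∑-apart : ∀ {n} (f : Vector ℤ n) i → ∑[ k < n ] (f k * + apart i k) ≡ sum f - f i
  ∑-apart {suc n} f zero = begin
    f zero * + 0 + ∑[ k < n ] (f (suc k) * + 1)
      ≡⟨ cong (λ t → f zero * + 0 + t) (sum-cong-≗ λ k → ℤ.*-identityʳ (f (suc k))) ⟩
    f zero * + 0 + sum (tail f)
      ≡⟨ drop-first (f zero) (sum (tail f)) ⟩
    sum f - f zero ∎
    where
    open ≡-Reasoning
    drop-first : ∀ x s → x * + 0 + s ≡ x + s - x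
    drop-first = solve-∀
  ∑-apart {suc n} f (suc i) = begin
    f zero * + 1 + ∑[ k < n ] (f (suc k) * + apart i k)
      ≡⟨ cong (λ t → f zero * + 1 + t) (∑-apart (tail f) i) ⟩
    f zero * + 1 + (sum (tail f) - f (suc i))
      ≡⟨ reassociate (f zero) (sum (tail f)) (f (suc i)) ⟩
    sum f - f (suc i) ∎
    where
    open ≡-Reasoning
    reassociate : ∀ x s y → x * + 1 + (s - y) ≡ x + s - y
    reassociate = solve-∀

  vertex : ∀ {a} → Fin (2 ℕ.+ a) → V (K a 1 1)
  vertex zero          = inj₂ (inj₁ zero)
  vertex (suc zero)    = inj₂ (inj₂ zero)
  vertex (suc (suc i)) = inj₁ i

  distance-form : ∀ {a} → Vector ℤ (2 ℕ.+ a) → ℤ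
  distance-form w = quadratic-form (λ p q → + distance (vertex p) (vertex q)) w

  balance : ∀ {a} → Vector ℤ (2 ℕ.+ a)
  balance zero          = + 1
  balance (suc zero)    = + 1
  balance (suc (suc _)) = + 2

  part-sum part-square-sum : ∀ {a} → Vector ℤ (2 ℕ.+ a) → ℤ
  part-sum        {a} w = ∑[ i < a ] w (suc (suc i))
  part-square-sum {a} w = ∑[ i < a ] (w (suc (suc i)) * w (suc (suc i)))

  ·-balance : ∀ {a} (w : Vector ℤ (2 ℕ.+ a)) → balance · w ≡ w zero + w (suc zero) + + 2 * part-sum w
  ·-balance w =
    trans (cong (λ t → + 1 * w zero + (+ 1 * w (suc zero) + t)) (sym (*-distribˡ-sum (+ 2) (tail (tail w)))))
          (unit-coefficients (w zero) (w (suc zero)) _)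
    where
    unit-coefficients : ∀ x y t → + 1 * x + (+ 1 * y + t) ≡ x + y + t
    unit-coefficients = solve-∀

  distance-form-value : ∀ {a} (w : Vector ℤ (2 ℕ.+ a)) →
    distance-form w ≡ + 2 * (w zero * w (suc zero) + (w zero + w (suc zero)) * part-sum w
                             + part-sum w * part-sum w - part-square-sum w)
  distance-form-value {a} w = begin
    distance-form w
      ≡⟨ cong₂ _+_ (cong (λ t → u * u * + 0 + (u * v * + 1 + t)) (hub-row u))
                   (cong₂ _+_ (cong (λ t → v * u * + 1 + (v * v * + 0 + t)) (hub-row v))
                              (trans (sum-cong-≗ part-row) (∑-linear (u + v + + 2 * s) (- + 2) x (λ i → x i * x i)))) ⟩
    (u * u * + 0 + (u * v * + 1 + u * s)) + ((v * u * + 1 + (v * v * + 0 + v * s)) + ((u + v + + 2 * s) * s + (- + 2) * T))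
      ≡⟨ collect-rows u v s T ⟩
    + 2 * (u * v + (u + v) * s + s * s - T) ∎
    where
    open ≡-Reasoning
    u v s T : ℤ
    u = w zero
    v = w (suc zero)
    s = part-sum w
    T = part-square-sum w
    x : Vector ℤ a
    x i = w (suc (suc i))

    hub-row : ∀ c → ∑[ i < a ] (c * x i * + 1) ≡ c * s
    hub-row c = trans (sum-cong-≗ λ i → ℤ.*-identityʳ (c * x i)) (sym (*-distribˡ-sum c x))

    part-row : ∀ i → x i * u * + 1 + (x i * v * + 1 + ∑[ k < a ] (x i * x k * + distance (inj₁ i) (inj₁ k)))
                   ≡ (u + v + + 2 * s) * x i + (- + 2) * (x i * x i)
    part-row i = trans (cong (λ t → x i * u * + 1 + (x i * v * + 1 + t)) inner) (collect (x i) u v s)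
      where
      inner : ∑[ k < a ] (x i * x k * + distance (inj₁ i) (inj₁ k)) ≡ + 2 * x i * (s - x i)
      inner = begin
        ∑[ k < a ] (x i * x k * + (2 ℕ.* apart i k))
          ≡⟨ sum-cong-≗ (λ k → trans (cong (x i * x k *_) (ℤ.pos-* 2 (apart i k)))
                                     (regroup (x i) (x k) (+ apart i k))) ⟩
        ∑[ k < a ] (+ 2 * x i * (x k * + apart i k))
          ≡⟨ *-distribˡ-sum (+ 2 * x i) (λ k → x k * + apart i k) ⟨
        + 2 * x i * ∑[ k < a ] (x k * + apart i k)
          ≡⟨ cong (+ 2 * x i *_) (∑-apart x i) ⟩
        + 2 * x i * (s - x i) ∎
        where
        regroup : ∀ y z d → y * z * (+ 2 * d) ≡ + 2 * y * (z * d)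
        regroup = solve-∀
      collect : ∀ y u v s →
        y * u * + 1 + (y * v * + 1 + + 2 * y * (s - y)) ≡ (u + v + + 2 * s) * y + (- + 2) * (y * y)
      collect = solve-∀

    collect-rows : ∀ u v s T →
      (u * u * + 0 + (u * v * + 1 + u * s)) + ((v * u * + 1 + (v * v * + 0 + v * s)) + ((u + v + + 2 * s) * s + (- + 2) * T))
        ≡ + 2 * (u * v + (u + v) * s + s * s - T)
    collect-rows = solve-∀

  sos-terms : ∀ {a} → Vector ℤ (2 ℕ.+ a) → Vector ℤ (suc a)
  sos-terms w zero    = w zero - w (suc zero)
  sos-terms w (suc i) = + 2 * w (suc (suc i))

  ∑-sos-terms : ∀ {a} (w : Vector ℤ (2 ℕ.+ a)) →
    ∑[ i < suc a ] (sos-terms w i * sos-terms w i)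
      ≡ (w zero - w (suc zero)) * (w zero - w (suc zero)) + + 4 * part-square-sum w
  ∑-sos-terms {a} w =
    cong (λ t → (w zero - w (suc zero)) * (w zero - w (suc zero)) + t)
         (trans (sum-cong-≗ λ i → quadruple (w (suc (suc i))))
                (sym (*-distribˡ-sum (+ 4) (λ i → w (suc (suc i)) * w (suc (suc i))))))
    where
    quadruple : ∀ x → + 2 * x * (+ 2 * x) ≡ + 4 * (x * x)
    quadruple = solve-∀

  distance-form-identity : ∀ {a} (w : Vector ℤ (2 ℕ.+ a)) →
    (balance · w) * (balance · w) - + 2 * distance-form w ≡ ∑[ i < suc a ] (sos-terms w i * sos-terms w i)
  distance-form-identity w = begin
    (balance · w) * (balance · w) - + 2 * distance-form w
      ≡⟨ cong₂ (λ e q → e * e - + 2 * q) (·-balance w) (distance-form-value w) ⟩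
    (u + v + + 2 * s) * (u + v + + 2 * s) - + 2 * (+ 2 * (u * v + (u + v) * s + s * s - T))
      ≡⟨ expand u v s T ⟩
    (u - v) * (u - v) + + 4 * T
      ≡⟨ ∑-sos-terms w ⟨
    ∑[ i < _ ] (sos-terms w i * sos-terms w i) ∎
    where
    open ≡-Reasoning
    u v s T : ℤ
    u = w zero
    v = w (suc zero)
    s = part-sum w
    T = part-square-sum w
    expand : ∀ u v s T → (u + v + + 2 * s) * (u + v + + 2 * s) - + 2 * (+ 2 * (u * v + (u + v) * s + s * s - T))
                         ≡ (u - v) * (u - v) + + 4 * T
    expand = solve-∀

  balanced-isotropic⇒zero : ∀ {a} (w : Vector ℤ (2 ℕ.+ a)) → balance · w ≡ 0ℤ → distance-form w ≡ 0ℤ →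
    ∀ p → w p ≡ 0ℤ
  balanced-isotropic⇒zero {a} w balanced isotropic = vanish
    where
    sos≡0 : ∀ i → sos-terms w i ≡ 0ℤ
    sos≡0 = ∑-squares≡0⇒≡0 (sos-terms w)
              (trans (sym (distance-form-identity w)) (cong₂ (λ e q → e * e - + 2 * q) balanced isotropic))

    u≡v : w zero ≡ w (suc zero)
    u≡v = ℤ.i-j≡0⇒i≡j (w zero) (w (suc zero)) (sos≡0 zero)

    part≡0 : ∀ i → w (suc (suc i)) ≡ 0ℤ
    part≡0 i = ℤ.*-cancelˡ-≡ (+ 2) (w (suc (suc i))) 0ℤ (sos≡0 (suc i))

    2u≡0 : + 2 * w zero ≡ 0ℤ
    2u≡0 = begin
      + 2 * w zero                                ≡⟨ double (w zero) ⟩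
      w zero + w zero + + 2 * 0ℤ                  ≡⟨ cong₂ (λ y t → w zero + y + + 2 * t) u≡v
                                                           (sym (trans (sum-cong-≗ part≡0) (sum-replicate-zero a))) ⟩
      w zero + w (suc zero) + + 2 * part-sum w    ≡⟨ ·-balance w ⟨
      balance · w                                 ≡⟨ balanced ⟩
      0ℤ                                          ∎
      where
      open ≡-Reasoning
      double : ∀ x → + 2 * x ≡ x + x + + 2 * 0ℤ
      double = solve-∀

    vanish : ∀ p → w p ≡ 0ℤ
    vanish zero          = ℤ.*-cancelˡ-≡ (+ 2) (w zero) 0ℤ 2u≡0
    vanish (suc zero)    = trans (sym u≡v) (vanish zero)
    vanish (suc (suc i)) = part≡0 i

  squashed-length : ∀ {a} M (g : V (K a 1 1) → Vec Sym M) → IsSquashed (K a 1 1) M g → a ℕ.+ 1 ℕ.≤ M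
  squashed-length {a} M g squashed =
    ℕ.≮⇒≥ λ M<a+1 →
      refute (nontrivial-solution (2 ℕ.+ a) (balance ∷ zero-indicators h) (fewer-equations M<a+1))
    where
    h : Fin (2 ℕ.+ a) → Vec Sym M
    h p = g (vertex p)

    fewer-equations : M ℕ.< a ℕ.+ 1 → suc (length (zero-indicators h)) ℕ.< 2 ℕ.+ a
    fewer-equations M<a+1 = subst (λ m → suc m ℕ.< 2 ℕ.+ a) (sym (length-zero-indicators h))
                                  (s≤s (subst (M ℕ.<_) (ℕ.+-comm a 1) M<a+1))

    refute : (∃ λ w → ¬ (∀ p → w p ≡ 0ℤ) × All (λ E → E · w ≡ 0ℤ) (balance ∷ zero-indicators h)) → ⊥
    refute (w , w≢0 , balanced ∷ indicators) = w≢0 (balanced-isotropic⇒zero w balanced isotropic)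
      where
      isotropic : distance-form w ≡ 0ℤ
      isotropic =
        trans (quadratic-form-cong w λ p q → cong +_ (sym (squashed-conflicts g squashed (vertex p) (vertex q))))
              (conflict-form-vanishes h w indicators)

open import Data.Nat using (_+_; _≤_)

mainTheorem11 : (a : ℕ) → 1 ≤ a → N₂≡ (K a 1 1) (a + 1)
mainTheorem11 a _ = (code , code-squashed) , squashed-length
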